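{- For every integer $n\ge 6$, $\varphi(n)\ge 2n+1$.
   Context: For a positive integer $n$, $\varphi(n)$ denotes the product of all odd primes less than $n$. -}

module Defs where

open import Data.Nat using (ℕ; zero; suc; _*_; _≟_)
open import Data.Nat.Primality using (prime?)
open import Relation.Nullary using (yes; no)

oddPrimeFactor : ℕ → ℕ
oddPrimeFactor k with prime? k | k ≟ 2
... | yes _ | no _  = k
... | _     | _     = 1

-- φ n = product of all odd primes p with p < n
φ : ℕ → ℕ
φ zero    = 1
φ (suc n) = oddPrimeFactor n * φ n

module Submission where

-- For n = 6 + m write φ n = 15 · P, where P = φFrom 6 m is the product of
-- the odd primes p with 6 ≤ p < n.  For n ≥ 8 the number E = 4P − 15 is at
-- least 13, and no prime below n divides it: every such prime divides
-- 4P · 15 = (E + 15) · 15, so it would divide 15 as well, whereas E and 15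
-- are coprime (a common prime divisor is 3 or 5; it cannot divide 4, and it
-- cannot divide P, whose prime divisors are all ≥ 6).  Hence some prime
-- divisor of E is ≥ n, so n ≤ E, i.e. n + 15 ≤ 4P, and then
-- 2n + 1 ≤ 2(n + 15) ≤ 8P ≤ 15P = φ n.  The cases n = 6, 7 are computed.

open import Defs
open import Data.Nat using (ℕ; _≤_; _*_; _+_)
open import Data.Nat.Base using (zero; suc; _<_; _∸_; z≤n; s≤s; >-nonZero; nonTrivial⇒n>1)
open import Data.Nat.Properties
open import Data.Nat.Divisibility
open import Data.Nat.Primality
open import Data.Nat.Primality.Factorisation using (factorise)
open import Data.List using ([]; _∷_)
open import Data.Nat.ListAction using (product)
open import Data.List.Relation.Unary.All using (_∷_)
open import Data.Sum using (_⊎_; inj₁; inj₂; [_,_])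
open import Data.Product using (∃; _×_; _,_)
open import Data.Empty using (⊥; ⊥-elim)
open import Relation.Nullary using (¬_; yes; no)
open import Relation.Nullary.Decidable using (from-yes)
open import Relation.Binary.PropositionalEquality using (_≡_; _≢_; refl; sym; trans; cong; subst; module ≡-Reasoning)

prime>1 : ∀ {p} → Prime p → 1 < p
prime>1 {p} pr = let instance _ = prime⇒nonTrivial pr in nonTrivial⇒n>1 p

prime∤1 : ∀ {p} → Prime p → ¬ p ∣ 1
prime∤1 pr p∣1 = <⇒≢ (prime>1 pr) (sym (∣1⇒≡1 p∣1))

oddPrimeFactor-cases : ∀ k → oddPrimeFactor k ≡ 1 ⊎ (oddPrimeFactor k ≡ k × Prime k)
oddPrimeFactor-cases k with prime? k | k ≟ 2
... | yes pk | no _  = inj₂ (refl , pk)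
... | yes _  | yes _ = inj₁ refl
... | no _   | _     = inj₁ refl

oddPrimeFactor-odd : ∀ {k} → Prime k → k ≢ 2 → oddPrimeFactor k ≡ k
oddPrimeFactor-odd {k} pk k≢2 with prime? k | k ≟ 2
... | yes _  | no _    = refl
... | yes _  | yes k≡2 = ⊥-elim (k≢2 k≡2)
... | no ¬pk | _       = ⊥-elim (¬pk pk)

φFrom : ℕ → ℕ → ℕ
φFrom k zero    = 1
φFrom k (suc m) = oddPrimeFactor (k + m) * φFrom k m

φ-split : ∀ k m → φ (k + m) ≡ φFrom k m * φ k
φ-split k zero    = trans (cong φ (+-identityʳ k)) (sym (*-identityˡ (φ k)))
φ-split k (suc m) = begin
  φ (k + suc m)                              ≡⟨ cong φ (+-suc k m) ⟩
  oddPrimeFactor (k + m) * φ (k + m)         ≡⟨ cong (oddPrimeFactor (k + m) *_) (φ-split k m) ⟩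
  oddPrimeFactor (k + m) * (φFrom k m * φ k) ≡⟨ sym (*-assoc (oddPrimeFactor (k + m)) (φFrom k m) (φ k)) ⟩
  φFrom k (suc m) * φ k                      ∎
  where open ≡-Reasoning

φFrom-positive : ∀ k m → 1 ≤ φFrom k m
φFrom-positive k zero    = ≤-refl
φFrom-positive k (suc m) = *-mono-≤ factor≥1 (φFrom-positive k m)
  where
  factor≥1 : 1 ≤ oddPrimeFactor (k + m)
  factor≥1 with oddPrimeFactor-cases (k + m)
  ... | inj₁ f≡1        = ≤-reflexive (sym f≡1)
  ... | inj₂ (f≡k+m , pk) = subst (1 ≤_) (sym f≡k+m) (<⇒≤ (prime>1 pk))

φFrom-divisible : ∀ k m {p} → Prime p → p ≢ 2 → k ≤ p → p < k + m → p ∣ φFrom k m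
φFrom-divisible k zero    pp p≢2 k≤p p<k+0 = ⊥-elim (<⇒≱ (subst (_ <_) (+-identityʳ k) p<k+0) k≤p)
φFrom-divisible k (suc m) {p} pp p≢2 k≤p p<k+m+1
  with m<1+n⇒m<n∨m≡n (subst (p <_) (+-suc k m) p<k+m+1)
... | inj₁ p<k+m  = ∣n⇒∣m*n (oddPrimeFactor (k + m)) (φFrom-divisible k m pp p≢2 k≤p p<k+m)
... | inj₂ refl   = ∣m⇒∣m*n (φFrom k m) (∣-reflexive (sym (oddPrimeFactor-odd pp p≢2)))

φFrom-primeDivisor : ∀ k m {r} → Prime r → r ∣ φFrom k m → k ≤ r
φFrom-primeDivisor k zero    pr r∣1 = ⊥-elim (prime∤1 pr r∣1)
φFrom-primeDivisor k (suc m) pr r∣φ with euclidsLemma (oddPrimeFactor (k + m)) (φFrom k m) pr r∣φ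
... | inj₂ r∣rest = φFrom-primeDivisor k m pr r∣rest
... | inj₁ r∣f with oddPrimeFactor-cases (k + m)
...   | inj₁ f≡1 = ⊥-elim (prime∤1 pr (subst (_ ∣_) f≡1 r∣f))
...   | inj₂ (f≡k+m , pk) with prime⇒irreducible pk (subst (_ ∣_) f≡k+m r∣f)
...     | inj₁ r≡1   = ⊥-elim (<⇒≢ (prime>1 pr) (sym r≡1))
...     | inj₂ r≡k+m = subst (k ≤_) (sym r≡k+m) (m≤m+n k m)

primeDivisor : ∀ {E} → 2 ≤ E → ∃ λ q → Prime q × q ∣ E
primeDivisor {E} 2≤E with factorise E {{>-nonZero (≤-trans (s≤s z≤n) 2≤E)}}
... | record { factors = [] ; isFactorisation = E≡1 } = ⊥-elim (<⇒≢ 2≤E (sym E≡1))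
... | record { factors = q ∷ qs ; isFactorisation = E≡q*Πqs ; factorsPrime = pq ∷ _ } =
  q , pq , divides (product qs) (trans E≡q*Πqs (*-comm q _))

-- If every prime below N divides (E + B) · B but E and B have no common
-- prime divisor, then no prime below N divides E; so if E ≥ 2, then E ≥ N.
euclid : ∀ N E B → 2 ≤ E →
         (∀ {q} → Prime q → q < N → q ∣ (E + B) * B) →
         (∀ {q} → Prime q → q ∣ E → q ∣ B → ⊥) →
         N ≤ E
euclid N E B 2≤E below-N-divides coprime with primeDivisor 2≤E
... | q , pq , q∣E = ≤-trans N≤q (∣⇒≤ {{>-nonZero (≤-trans (s≤s z≤n) 2≤E)}} q∣E)
  where
  q∣B-if-below-N : q < N → q ∣ B
  q∣B-if-below-N q<N with euclidsLemma (E + B) B pq (below-N-divides pq q<N)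
  ... | inj₁ q∣E+B = ∣m+n∣m⇒∣n q∣E+B q∣E
  ... | inj₂ q∣B   = q∣B

  N≤q : N ≤ q
  N≤q with q <? N
  ... | yes q<N = ⊥-elim (coprime pq q∣E (q∣B-if-below-N q<N))
  ... | no q≮N  = ≮⇒≥ q≮N

∣60 : ∀ {q} → 0 < q → q < 6 → q ∣ 4 * 15
∣60 {1} _ _ = from-yes (1 ∣? 60)
∣60 {2} _ _ = from-yes (2 ∣? 60)
∣60 {3} _ _ = from-yes (3 ∣? 60)
∣60 {4} _ _ = from-yes (4 ∣? 60)
∣60 {5} _ _ = from-yes (5 ∣? 60)
∣60 {suc (suc (suc (suc (suc (suc _)))))} _ (s≤s (s≤s (s≤s (s≤s (s≤s (s≤s ()))))))

primeDivisor15≤5 : ∀ {q} → Prime q → q ∣ 15 → q ≤ 5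
primeDivisor15≤5 pq q∣15 with euclidsLemma 3 5 pq q∣15
... | inj₁ q∣3 = ≤-trans (∣⇒≤ q∣3) (m≤m+n 3 2)
... | inj₂ q∣5 = ∣⇒≤ q∣5

-- No prime divides both 4 and 15, since such a prime would divide 16 − 15.
¬prime∣4∧15 : ∀ {q} → Prime q → q ∣ 4 → q ∣ 15 → ⊥
¬prime∣4∧15 pq q∣4 q∣15 = prime∤1 pq (∣m+n∣m⇒∣n (∣m⇒∣m*n 4 q∣4) q∣15)

-- The key estimate: for n = 6 + m ≥ 8 and P the product of the odd primes
-- in [6, n), n + 15 ≤ 4P.  It is Euclid's argument applied to E = 4P − 15.
keyBound : ∀ m → 2 ≤ m → 6 + m + 15 ≤ 4 * φFrom 6 m
keyBound m 2≤m = subst (6 + m + 15 ≤_) E+15≡4P (+-monoˡ-≤ 15 n≤E)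
  where
  n = 6 + m
  P = φFrom 6 m

  -- 7 lies in the range [6, n), so P ≥ 7.
  7≤P : 7 ≤ P
  7≤P = ∣⇒≤ {{>-nonZero (φFrom-positive 6 m)}}
          (φFrom-divisible 6 m (from-yes (prime? 7)) (λ ()) (m≤n+m 6 1) (+-monoʳ-≤ 6 2≤m))

  E = 4 * P ∸ 15

  15≤4P : 15 ≤ 4 * P
  15≤4P = ≤-trans (m≤m+n 15 13) (*-monoʳ-≤ 4 7≤P)

  E+15≡4P : E + 15 ≡ 4 * P
  E+15≡4P = m∸n+n≡m 15≤4P

  2≤E : 2 ≤ E
  2≤E = +-cancelʳ-≤ 15 2 E (subst (17 ≤_) (sym E+15≡4P) (≤-trans (m≤m+n 17 11) (*-monoʳ-≤ 4 7≤P)))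

  -- Every prime below n divides 4P · 15: the small ones divide 60, the
  -- others are odd primes in [6, n) and divide P.
  below-n-divides : ∀ {q} → Prime q → q < n → q ∣ (E + 15) * 15
  below-n-divides {q} pq q<n = subst (λ x → q ∣ x * 15) (sym E+15≡4P) q∣4P*15
    where
    q∣4P*15 : q ∣ 4 * P * 15
    q∣4P*15 with q <? 6
    ... | yes q<6 = ∣-trans (∣60 (<⇒≤ (prime>1 pq)) q<6) (*-monoˡ-∣ 15 (m∣m*n {4} P))
    ... | no q≮6  = ∣m⇒∣m*n 15 (∣n⇒∣m*n 4 (φFrom-divisible 6 m pq (λ { refl → q≮6 (s≤s (s≤s (s≤s z≤n))) }) (≮⇒≥ q≮6) q<n))

  -- A common prime divisor of E and 15 would divide 4P, hence 4 or P.
  coprime : ∀ {q} → Prime q → q ∣ E → q ∣ 15 → ⊥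
  coprime {q} pq q∣E q∣15 = [ q∤4 , q∤P ] (euclidsLemma 4 P pq q∣4P)
    where
    q∣4P : q ∣ 4 * P
    q∣4P = subst (q ∣_) E+15≡4P (∣m∣n⇒∣m+n q∣E q∣15)
    q∤4 : ¬ q ∣ 4
    q∤4 q∣4 = ¬prime∣4∧15 pq q∣4 q∣15
    q∤P : ¬ q ∣ P
    q∤P q∣P = <⇒≱ (s≤s (primeDivisor15≤5 pq q∣15)) (φFrom-primeDivisor 6 m pq q∣P)

  n≤E : n ≤ E
  n≤E = euclid n E 15 2≤E below-n-divides coprime

lemma2p6 : (n : ℕ) → 6 ≤ n → 2 * n + 1 ≤ φ n
lemma2p6 n 6≤n = subst (λ n → 2 * n + 1 ≤ φ n) (m+[n∸m]≡n 6≤n) (bound (n ∸ 6))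
  where
  bound : ∀ m → 2 * (6 + m) + 1 ≤ φ (6 + m)
  bound 0 = from-yes (13 ≤? φ 6)
  bound 1 = from-yes (15 ≤? φ 7)
  bound m@(suc (suc _)) = begin
    2 * (6 + m) + 1   ≤⟨ +-monoʳ-≤ (2 * (6 + m)) (s≤s z≤n) ⟩
    2 * (6 + m) + 30  ≡⟨ sym (*-distribˡ-+ 2 (6 + m) 15) ⟩
    2 * (6 + m + 15)  ≤⟨ *-monoʳ-≤ 2 (keyBound m (s≤s (s≤s z≤n))) ⟩
    2 * (4 * P)       ≡⟨ sym (*-assoc 2 4 P) ⟩
    8 * P             ≤⟨ *-monoˡ-≤ P (m≤m+n 8 7) ⟩
    15 * P            ≡⟨ *-comm 15 P ⟩
    P * φ 6           ≡⟨ sym (φ-split 6 m) ⟩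
    φ (6 + m)         ∎
    where
    P = φFrom 6 m
    open ≤-Reasoning
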